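{- Let $\mathbf{d}=(d_1\ge d_2\ge\cdots\ge d_n)$ be a zero-free graphical degree sequence of length $n$. Then $\mathbf{d}$ is forcibly biconnected if and only if all of the following hold: (i) $\mathbf{d}$ is potentially biconnected; (ii) $\mathbf{d}$ is forcibly connected; (iii) either $d_2+d_n\ge n$, or there do NOT exist a term value $d$ occurring in $\mathbf{d}$, an integer $s$, a sub-multiset $\mathbf{s_L}$ and an integer $d'$ satisfying all of the following: (a) $d_n\le s\le \lfloor (n-1)/2\rfloor$, $d_{n-s+1}\le s$ and $d_2\le n-s-1$; (b) $d=d_1$ or $n-s-1\ge d_1$; (c) $\mathbf{s_L}$ is a sub-multiset of size exactly $s$ of the multiset $\mathbf{d_L}$, where $\mathbf{d_L}$ is the multiset of all terms $d_i$ of $\mathbf{d}$ with $d_i\le s$, with one copy of $d$ removed from it if $d$ occurs in it (i.e. if $d\le s$); (d) $1\le d'\le d-1$; (e) both the multiset $\mathbf{s'_L}=\mathbf{s_L}\cup\{d'\}$ (of size $s+1$) and the multiset $\mathbf{s'_H}=\big(\mathbf{d}-(\{d\}\cup\mathbf{s_L})\big)\cup\{d-d'\}$ (of size $n-s$) have even sum and are graphical. In particular, the procedure that returns False if (i) or (ii) fails, returns True if $d_2+d_n\ge n$, and otherwise searches exhaustively over all $(d,s,\mathbf{s_L},d')$ satisfying (a)–(d), returning False if one satisfying (e) is found and True otherwise, correctly decides whether $\mathbf{d}$ is forcibly biconnected.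
   Context: All graphs are finite simple graphs. A graphical degree sequence is a finite multiset of non-negative integers (written in non-increasing order) that is the vertex degree sequence of some finite simple graph, called a realization; it is zero-free if all terms are positive. A graph is biconnected if it is connected, has at least three vertices, and has no cut vertex (a vertex whose removal disconnects the graph). A graphical degree sequence is potentially P-graphic (for a graph property P) if at least one of its realizations has property P, and forcibly P-graphic if all of its realizations have property P; "potentially/forcibly connected" and "potentially/forcibly biconnected" are used in this sense. Sequences/collections are treated as multisets: $\mathbf{d}-\mathbf{A}$ removes one copy of each element of $\mathbf{A}$ (with multiplicity) from $\mathbf{d}$, and $\cup$ denotes multiset union (adding elements with multiplicity). -}

module Defs where

open import Data.Nat using (ℕ; zero; suc; _+_; _∸_; _≤_; _<_; _≟_; _≤?_)
open import Data.Nat.DivMod using (_/_)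
open import Data.Nat.Divisibility using (_∣_)
open import Data.Bool using (Bool; true; false; if_then_else_)
open import Data.Fin using (Fin)
open import Data.List using (List; []; _∷_; length; map; filter; allFin; lookup)
open import Data.Nat.ListAction using (sum)
open import Data.List.Relation.Unary.All using (All)
open import Data.List.Relation.Unary.Linked using (Linked)
open import Data.List.Membership.Propositional using (_∈_)
open import Data.List.Relation.Binary.Permutation.Propositional using (_↭_)
open import Data.List using (_++_)
open import Data.Product using (Σ; ∃; _×_)
open import Data.Sum using (_⊎_)
open import Data.Unit using (⊤)
open import Relation.Nullary using (¬_; yes; no)
open import Relation.Binary.PropositionalEquality using (_≡_; _≢_)

record Graph (n : ℕ) : Set where
  field
    adj    : Fin n → Fin n → Bool
    sym    : ∀ i j → adj i j ≡ adj j i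
    irrefl : ∀ i → adj i i ≡ false
open Graph public

deg : ∀ {n} → Graph n → Fin n → ℕ
deg {n} G i = sum (map (λ j → if adj G i j then 1 else 0) (allFin n))

-- Walks all of whose vertices after the first satisfy `ok`
data ReachIn {n} (G : Graph n) (ok : Fin n → Set) : Fin n → Fin n → Set where
  here : ∀ {u} → ReachIn G ok u u
  step : ∀ {u w v} → adj G u w ≡ true → ok w → ReachIn G ok w v → ReachIn G ok u v

Connected : ∀ {n} → Graph n → Set
Connected {n} G = (1 ≤ n) × (∀ u v → ReachIn G (λ _ → ⊤) u v)

Biconnected : ∀ {n} → Graph n → Set
Biconnected {n} G =
  Connected G × (3 ≤ n) ×
  (∀ x u v → u ≢ x → v ≢ x → ReachIn G (λ w → w ≢ x) u v)

Realizes : (d : List ℕ) → Graph (length d) → Set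
Realizes d G = ∀ i → deg G i ≡ lookup d i

Graphical : List ℕ → Set
Graphical d = Σ (Graph (length d)) (Realizes d)

PotentiallyP : (∀ {n} → Graph n → Set) → List ℕ → Set
PotentiallyP P d = Σ (Graph (length d)) λ G → Realizes d G × P G

ForciblyP : (∀ {n} → Graph n → Set) → List ℕ → Set
ForciblyP P d = ∀ (G : Graph (length d)) → Realizes d G → P G

NonIncreasing : List ℕ → Set
NonIncreasing = Linked (λ a b → b ≤ a)

ZeroFree : List ℕ → Set
ZeroFree = All (λ x → 1 ≤ x)

-- 1-indexed access d_i (0 if out of range; only used for in-range indices)
_!_ : List ℕ → ℕ → ℕ
[] ! _ = 0
(x ∷ xs) ! zero = 0
(x ∷ xs) ! suc zero = x
(x ∷ xs) ! suc (suc i) = xs ! suc i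

removeOne : ℕ → List ℕ → List ℕ
removeOne a [] = []
removeOne a (x ∷ xs) with a ≟ x
... | yes _ = xs
... | no _ = x ∷ removeOne a xs

_∖ₘ_ : List ℕ → List ℕ → List ℕ
xs ∖ₘ [] = xs
xs ∖ₘ (a ∷ as) = removeOne a xs ∖ₘ as

_⊆ₘ_ : List ℕ → List ℕ → Set
A ⊆ₘ B = ∃ λ rest → B ↭ A ++ rest

dL : List ℕ → ℕ → ℕ → List ℕ
dL ds d s = removeOne d (filter (_≤? s) ds)

Witness : (ds : List ℕ) (d s : ℕ) (sL : List ℕ) (d' : ℕ) → Set
Witness ds d s sL d' =
  let n = length ds in
  (d ∈ ds) ×
  ((ds ! n) ≤ s) × (s ≤ (n ∸ 1) / 2) × ((ds ! (n ∸ s + 1)) ≤ s) × ((ds ! 2) ≤ n ∸ s ∸ 1) ×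
  ((d ≡ ds ! 1) ⊎ ((ds ! 1) ≤ n ∸ s ∸ 1)) ×
  (length sL ≡ s) × (sL ⊆ₘ dL ds d s) ×
  (1 ≤ d') × (d' ≤ d ∸ 1) ×
  (2 ∣ sum (d' ∷ sL)) × Graphical (d' ∷ sL) ×
  (2 ∣ sum ((d ∸ d') ∷ (ds ∖ₘ (d ∷ sL)))) × Graphical ((d ∸ d') ∷ (ds ∖ₘ (d ∷ sL)))

module Submission where

-- If a witness exists, realize d' ∷ sL and (d ∸ d') ∷ (d minus {d} ∪ sL) by two graphs and identify
-- their first vertices: the result realizes d, and the identified vertex (of degree d) is a cut
-- vertex, since both remaining parts are nonempty (1 ≤ dₙ ≤ s ≤ (n - 1)/2).
--
-- Conversely, let x be a cut vertex of a connected realization G. Removing x splits the other vertices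
-- into the component L of some vertex and the rest H, with no edges between them; swapping the sides
-- if necessary, s = |L| ≤ |H| = n - s - 1. A vertex of L has degree at most s, every vertex other than
-- x has degree at most n - s - 1, and x has d' ≥ 1 neighbours in L and d - d' ≥ 1 in H. The subgraphs
-- induced on x ∪ L and x ∪ H realize d' ∷ sL and (d ∸ d') ∷ sH, where sL, sH are the degrees in L, H;
-- this is a witness, and d₂ + dₙ ≤ (n - s - 1) + s < n. Finding L needs reachability in G - x to be
-- decidable, which follows by iterating the balls around a vertex until they stop growing.

open import Defs renaming (sym to adj-sym)
open import Data.Bool using (Bool; true; false; if_then_else_)
import Data.Bool.Properties as Boolₚ
open import Data.Empty using (⊥; ⊥-elim)
open import Data.Fin as Fin using (Fin; zero; suc; cast; splitAt; _↑ˡ_; _↑ʳ_)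
import Data.Fin.Properties as Finₚ
open import Data.Fin.Subset using (Subset; _⊂_; ∣_∣) renaming (_∈_ to _∈ₛ_)
open import Data.Fin.Subset.Properties using (p⊂q⇒∣p∣<∣q∣; ∣p∣≤n)
open import Data.List using (List; []; _∷_; _++_; length; map; filter; allFin; lookup; tabulate)
open import Data.List.Properties
  using (map-tabulate; tabulate-lookup; length-tabulate; lookup-tabulate; map-cong; map-cong-local; map-++; length-map;
         length-++; ++-assoc; filter-accept; filter-reject; filter-all; filter-none; filter-++; length-filter)
open import Data.List.Membership.Propositional using (_∈_; _∉_)
open import Data.List.Membership.Propositional.Properties
  using (∈-filter⁺; ∈-filter⁻; ∈-allFin; ∈-lookup; ∈-++⁺ˡ; ∈-++⁻)
open import Data.List.Relation.Unary.Any as Any using (here; there)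
open import Data.List.Relation.Unary.All as All using (All; []; _∷_)
open import Data.List.Relation.Unary.All.Properties using () renaming (++⁺ to All-++⁺; map⁺ to All-map⁺)
open import Data.List.Relation.Unary.Linked using ([]; _∷_)
open import Data.List.Relation.Unary.Unique.Propositional using (Unique; _∷_)
open import Data.List.Relation.Unary.Unique.Propositional.Properties using (allFin⁺; Unique[x∷xs]⇒x∉xs)
open import Data.List.Relation.Binary.Permutation.Propositional
  using (_↭_; ↭⇒↭ₛ; prep; swap; ↭-refl; ↭-sym; ↭-trans; ↭-reflexive)
open import Data.List.Relation.Binary.Permutation.Propositional.Properties
  using (map⁺; ++⁺ˡ; ++⁺ʳ; ++⁺; ++-comm; shift; drop-∷; ↭-length; filter-↭; ∈-resp-↭)
open import Data.List.Relation.Binary.Permutation.Setoid.Properties using (onIndices-lookup; Unique-resp-↭)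
open import Data.Nat using (ℕ; zero; suc; _+_; _*_; _∸_; _≤_; _<_; _≥_; _≟_; _≤?_; z≤n; s≤s)
open import Data.Nat.Divisibility using (_∣_; divides; ∣m∣n⇒∣m+n)
open import Data.Nat.DivMod using (_/_; m/n*n≤m; m*n/n≡m; /-monoˡ-≤)
open import Data.Nat.ListAction using (sum)
open import Data.Nat.ListAction.Properties using (sum-++; sum-↭)
open import Data.Nat.Properties
open import Data.Product using (Σ; _×_; _,_; proj₁; proj₂)
open import Data.Sum as Sum using (_⊎_; inj₁; inj₂; [_,_]′)
open import Data.Unit using (⊤; tt)
import Data.Vec as Vec
open import Data.Vec.Properties using (lookup∘tabulate; lookup⇒[]=; []=⇒lookup)
open import Function using (_∘_; case_of_; _↔_; Inverse; mk↔ₛ′)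
open import Function.Bundles using (_⇔_; mk⇔)
open import Function.Properties.Inverse using (↔-sym)
import Relation.Binary.PropositionalEquality as ≡
open import Relation.Binary.PropositionalEquality
  using (_≡_; _≢_; refl; sym; trans; cong; cong₂; subst; subst₂; module ≡-Reasoning)
open import Relation.Nullary using (¬_; Dec; yes; no; does; ¬?; _×-dec_; _⊎-dec_; _→-dec_)
open import Relation.Nullary.Decidable using (dec-true; decidable-stable)
open import Relation.Unary using (Decidable)
open import Algebra.Properties.CommutativeMonoid.Sum +-0-commutativeMonoid
  using (sum-syntax; sum-cong-≗; sum-replicate-zero; ∑-distrib-+; ∑-permute)
open import Data.List.Membership.DecPropositional _≟_ using (_∈?_)
import Data.List.Relation.Binary.Permutation.Setoid (≡.setoid ℕ) as Permₛ

m+m≡m*2 : ∀ m → m + m ≡ m * 2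
m+m≡m*2 m = trans (cong (m +_) (sym (+-identityʳ m))) (*-comm 2 m)

edge : ∀ {n} → Graph n → Fin n → Fin n → ℕ
edge G i j = if adj G i j then 1 else 0

edge-sym : ∀ {n} (G : Graph n) i j → edge G i j ≡ edge G j i
edge-sym G i j = cong (λ b → if b then 1 else 0) (adj-sym G i j)

edge-irrefl : ∀ {n} (G : Graph n) i → edge G i i ≡ 0
edge-irrefl G i = cong (λ b → if b then 1 else 0) (irrefl G i)

edge≤1 : ∀ {n} (G : Graph n) i j → edge G i j ≤ 1
edge≤1 G i j with adj G i j
... | true = ≤-refl
... | false = z≤n

sum-tabulate : ∀ {n} (f : Fin n → ℕ) → sum (tabulate f) ≡ ∑[ i < n ] f i
sum-tabulate {zero} f = refl
sum-tabulate {suc n} f = cong (f zero +_) (sum-tabulate (f ∘ suc))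

sum-map-allFin : ∀ {n} (f : Fin n → ℕ) → sum (map f (allFin n)) ≡ ∑[ i < n ] f i
sum-map-allFin f = trans (cong sum (map-tabulate (λ i → i) f)) (sum-tabulate f)

deg≡∑ : ∀ {n} (G : Graph n) i → deg G i ≡ ∑[ j < n ] edge G i j
deg≡∑ G i = sum-map-allFin (edge G i)

∑∑-even : ∀ {n} (f : Fin n → Fin n → ℕ) → (∀ i j → f i j ≡ f j i) → (∀ i → f i i ≡ 0) →
  2 ∣ ∑[ i < n ] ∑[ j < n ] f i j
∑∑-even {zero} f symm diag = divides 0 refl
∑∑-even {suc n} f symm diag = subst (2 ∣_) (sym split) (∣m∣n⇒∣m+n (divides A (m+m≡m*2 A)) rest)
  where
  A B : ℕ
  A = ∑[ j < n ] f zero (suc j)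
  B = ∑[ i < n ] ∑[ j < n ] f (suc i) (suc j)
  rest : 2 ∣ B
  rest = ∑∑-even (λ i j → f (suc i) (suc j)) (λ i j → symm (suc i) (suc j)) (diag ∘ suc)
  open ≡-Reasoning
  split : ∑[ i < suc n ] ∑[ j < suc n ] f i j ≡ (A + A) + B
  split = begin
      (f zero zero + A) + ∑[ i < n ] (f (suc i) zero + ∑[ j < n ] f (suc i) (suc j))
    ≡⟨ cong₂ _+_ (cong (_+ A) (diag zero)) (∑-distrib-+ (λ i → f (suc i) zero) (λ i → ∑[ j < n ] f (suc i) (suc j))) ⟩
      A + (∑[ i < n ] f (suc i) zero + B)
    ≡⟨ cong (λ t → A + (t + B)) (sum-cong-≗ {x = λ i → f (suc i) zero} (λ i → symm (suc i) zero)) ⟩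
      A + (A + B)
    ≡⟨ sym (+-assoc A A B) ⟩
      (A + A) + B ∎

realizes⇒map-deg≡ : ∀ {ds} {G : Graph (length ds)} → Realizes ds G → map (deg G) (allFin (length ds)) ≡ ds
realizes⇒map-deg≡ {ds} R = trans (map-cong R (allFin (length ds)))
  (trans (map-tabulate (λ i → i) (lookup ds)) (tabulate-lookup ds))

graphical⇒even : ∀ {ds} → Graphical ds → 2 ∣ sum ds
graphical⇒even {ds} (G , R) = subst (2 ∣_) degree-sum
  (∑∑-even (edge G) (edge-sym G) (edge-irrefl G))
  where
  degree-sum : ∑[ i < length ds ] ∑[ j < length ds ] edge G i j ≡ sum ds
  degree-sum = trans (sum-cong-≗ (λ i → sym (deg≡∑ G i)))
    (trans (sym (sum-map-allFin (deg G))) (cong sum (realizes⇒map-deg≡ {ds} {G} R)))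

edgesTo : ∀ {n} → Graph n → Fin n → List (Fin n) → ℕ
edgesTo G w vs = sum (map (edge G w) vs)

sum-map-≡0 : ∀ {A : Set} {f : A → ℕ} {vs} → All (λ v → f v ≡ 0) vs → sum (map f vs) ≡ 0
sum-map-≡0 [] = refl
sum-map-≡0 (e ∷ es) = cong₂ _+_ e (sum-map-≡0 es)

sum-map-≤ : ∀ {A : Set} {f : A → ℕ} vs → (∀ v → f v ≤ 1) → sum (map f vs) ≤ length vs
sum-map-≤ [] _ = z≤n
sum-map-≤ (v ∷ vs) f≤1 = +-mono-≤ (f≤1 v) (sum-map-≤ vs f≤1)

sum-map-< : ∀ {A : Set} {f : A → ℕ} {w} vs → (∀ v → f v ≤ 1) → w ∈ vs → f w ≡ 0 →
  suc (sum (map f vs)) ≤ length vs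
sum-map-< {f = f} (v ∷ vs) f≤1 (here refl) fw≡0 =
  s≤s (subst (λ t → t + sum (map f vs) ≤ length vs) (sym fw≡0) (sum-map-≤ vs f≤1))
sum-map-< {f = f} (v ∷ vs) f≤1 (there w∈) fw≡0 =
  subst (_≤ suc (length vs)) (+-suc (f v) _) (+-mono-≤ (f≤1 v) (sum-map-< vs f≤1 w∈ fw≡0))

sum-map-∈ : ∀ {A : Set} {f : A → ℕ} {w vs} → w ∈ vs → f w ≤ sum (map f vs)
sum-map-∈ {f = f} {vs = v ∷ vs} (here refl) = m≤m+n (f v) _
sum-map-∈ {f = f} {vs = v ∷ vs} (there w∈) = ≤-trans (sum-map-∈ w∈) (m≤n+m _ (f v))

∑-lookup : ∀ {A : Set} (f : A → ℕ) (ws : List A) → ∑[ j < length ws ] f (lookup ws j) ≡ sum (map f ws)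
∑-lookup f ws = trans (sym (sum-tabulate (f ∘ lookup ws)))
  (cong sum (trans (sym (map-tabulate (lookup ws) f)) (cong (map f) (tabulate-lookup ws))))

pull : ∀ {m n} → (Fin m → Fin n) → Graph n → Graph m
pull f G = record
  { adj = λ i j → adj G (f i) (f j)
  ; sym = λ i j → adj-sym G (f i) (f j)
  ; irrefl = λ i → irrefl G (f i)
  }

relabel : ∀ {m n} → Fin m ↔ Fin n → Graph m → Graph n
relabel π = pull (Inverse.from π)

deg-relabel : ∀ {m n} (π : Fin m ↔ Fin n) (G : Graph m) i → deg (relabel π G) i ≡ deg G (Inverse.from π i)
deg-relabel π G i = begin
    deg (relabel π G) i
  ≡⟨ deg≡∑ (relabel π G) i ⟩
    ∑[ j < _ ] edge G (from i) (from j)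
  ≡⟨ ∑-permute (edge G (from i)) (↔-sym π) ⟨
    ∑[ k < _ ] edge G (from i) k
  ≡⟨ deg≡∑ G (from i) ⟨
    deg G (from i) ∎
  where
  open Inverse π
  open ≡-Reasoning

↭-indices : ∀ {xs ys : List ℕ} → xs ↭ ys → Fin (length xs) ↔ Fin (length ys)
↭-indices p = Permₛ.onIndices (↭⇒↭ₛ p)

realizes-↭ : ∀ {xs ys} (p : xs ↭ ys) {G : Graph (length xs)} → Realizes xs G → Realizes ys (relabel (↭-indices p) G)
realizes-↭ {xs} {ys} p {G} R i = begin
    deg (relabel π G) i
  ≡⟨ deg-relabel π G i ⟩
    deg G (from i)
  ≡⟨ R (from i) ⟩
    lookup xs (from i)
  ≡⟨ onIndices-lookup (≡.setoid ℕ) (↭⇒↭ₛ p) (from i) ⟩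
    lookup ys (to (from i))
  ≡⟨ cong (lookup ys) (strictlyInverseˡ i) ⟩
    lookup ys i ∎
  where
  π : Fin (length xs) ↔ Fin (length ys)
  π = ↭-indices p
  open Inverse π
  open ≡-Reasoning

graphical-↭ : ∀ {xs ys} → xs ↭ ys → Graphical xs → Graphical ys
graphical-↭ p (G , R) = relabel (↭-indices p) G , realizes-↭ p {G} R

-- length (tabulate f) is n only up to propositional equality, hence the cast.
tabulate-indices : ∀ {n} (f : Fin n → ℕ) → Fin n ↔ Fin (length (tabulate f))
tabulate-indices f = mk↔ₛ′ (cast (sym len)) (cast len)
  (Finₚ.cast-involutive (sym len) len) (Finₚ.cast-involutive len (sym len))
  where len = length-tabulate f

realizes-tabulate : ∀ {n} {f : Fin n → ℕ} {G : Graph n} → (∀ i → deg G i ≡ f i) →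
  Realizes (tabulate f) (relabel (tabulate-indices f) G)
realizes-tabulate {f = f} {G} R i = begin
    deg (relabel (tabulate-indices f) G) i
  ≡⟨ deg-relabel (tabulate-indices f) G i ⟩
    deg G (from i)
  ≡⟨ R (from i) ⟩
    f (from i)
  ≡⟨ lookup-tabulate f (from i) ⟨
    lookup (tabulate f) (to (from i))
  ≡⟨ cong (lookup (tabulate f)) (strictlyInverseˡ i) ⟩
    lookup (tabulate f) i ∎
  where
  open Inverse (tabulate-indices f)
  open ≡-Reasoning

induced-graphical : ∀ {n} (G : Graph n) (ws : List (Fin n)) → Graphical (map (λ w → edgesTo G w ws) ws)
induced-graphical G ws = subst Graphical listed
  (relabel (tabulate-indices degree) H , realizes-tabulate {G = H} degrees)
  where
  H : Graph (length ws)
  H = pull (lookup ws) G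
  degree : Fin (length ws) → ℕ
  degree i = edgesTo G (lookup ws i) ws
  degrees : ∀ i → deg H i ≡ degree i
  degrees i = trans (deg≡∑ H i) (∑-lookup (edge G (lookup ws i)) ws)
  listed : tabulate degree ≡ map (λ w → edgesTo G w ws) ws
  listed = trans (sym (map-tabulate (lookup ws) _)) (cong (map _) (tabulate-lookup ws))

AllReachable : ∀ {n} → Graph n → Set
AllReachable G = ∀ a b → ReachIn G (λ _ → ⊤) a b

ReachIn-snoc : ∀ {n} {G : Graph n} {ok : Fin n → Set} {a b c} →
  ReachIn G ok a b → adj G b c ≡ true → ok c → ReachIn G ok a c
ReachIn-snoc here e o = step e o here
ReachIn-snoc (step e' o' r) e o = step e' o' (ReachIn-snoc r e o)

reach-pull : ∀ {m n} {G : Graph n} {okH : Fin m → Set} {okG : Fin n → Set} (f : Fin m → Fin n) →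
  (∀ w → okH w → okG (f w)) → ∀ {a b} → ReachIn (pull f G) okH a b → ReachIn G okG (f a) (f b)
reach-pull f ok-f here = here
reach-pull f ok-f (step e o r) = step e (ok-f _ o) (reach-pull f ok-f r)

ReachIn-exit : ∀ {n} {G : Graph n} {ok : Fin n → Set} {P : Fin n → Set} (P? : ∀ v → Dec (P v)) {a b} →
  ReachIn G ok a b → P a → ¬ P b → Σ (Fin n) λ p → Σ (Fin n) λ q → P p × ¬ P q × adj G p q ≡ true
ReachIn-exit P? here pa ¬pb = ⊥-elim (¬pb pa)
ReachIn-exit P? (step {u} {w} e _ r) pu ¬pb with P? w
... | yes pw = ReachIn-exit P? r pw ¬pb
... | no ¬pw = u , w , pu , ¬pw , e

Separates : ∀ {n} → Graph n → Fin n → Fin n → Fin n → Set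
Separates G x u v = u ≢ x × v ≢ x × ¬ ReachIn G (λ w → w ≢ x) u v

HasCutVertex : ∀ {n} → Graph n → Set
HasCutVertex {n} G = Σ (Fin n) λ x → Σ (Fin n) λ u → Σ (Fin n) λ v → Separates G x u v

cutVertex⇒¬biconnected : ∀ {n} {G : Graph n} → HasCutVertex G → ¬ Biconnected G
cutVertex⇒¬biconnected (x , u , v , u≢x , v≢x , ¬reach) (_ , _ , noCut) = ¬reach (noCut x u v u≢x v≢x)

cutVertex-relabel : ∀ {m n} (π : Fin m ↔ Fin n) {G : Graph m} → HasCutVertex G → HasCutVertex (relabel π G)
cutVertex-relabel π {G} (x , u , v , u≢x , v≢x , ¬reach) =
  to x , to u , to v , to-≢ u≢x , to-≢ v≢x , λ r → ¬reach (pullBack r)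
  where
  open Inverse π
  to-≢ : ∀ {w} → w ≢ x → to w ≢ to x
  to-≢ w≢x eq = w≢x (trans (sym (strictlyInverseʳ _)) (trans (cong from eq) (strictlyInverseʳ x)))
  pullBack : ReachIn (relabel π G) (λ w → w ≢ to x) (to u) (to v) → ReachIn G (λ w → w ≢ x) u v
  pullBack r = subst₂ (ReachIn G (λ w → w ≢ x)) (strictlyInverseʳ u) (strictlyInverseʳ v)
    (reach-pull from (λ w w≢ eq → w≢ (trans (sym (strictlyInverseˡ w)) (cong to eq))) r)

cutVertex-↭ : ∀ {xs ys} → xs ↭ ys → PotentiallyP HasCutVertex xs → PotentiallyP HasCutVertex ys
cutVertex-↭ p (G , R , cut) = relabel (↭-indices p) G , realizes-↭ p {G} R , cutVertex-relabel (↭-indices p) cut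

-- Gluing two graphs at a vertex

∑-splitAt : ∀ p {q} (g : Fin p ⊎ Fin q → ℕ) →
  ∑[ k < p + q ] g (splitAt p k) ≡ ∑[ a < p ] g (inj₁ a) + ∑[ b < q ] g (inj₂ b)
∑-splitAt zero g = refl
∑-splitAt (suc p) g = trans (cong (g (inj₁ zero) +_) (∑-splitAt p (g ∘ Sum.map₁ suc)))
  (sym (+-assoc (g (inj₁ zero)) _ _))

tabulate-splitAt : ∀ p {q} (h : Fin p ⊎ Fin q → ℕ) →
  tabulate (h ∘ splitAt p) ≡ tabulate (h ∘ inj₁) ++ tabulate (h ∘ inj₂)
tabulate-splitAt zero h = refl
tabulate-splitAt (suc p) h = cong (h (inj₁ zero) ∷_) (tabulate-splitAt p (h ∘ Sum.map₁ suc))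

deg-zero : ∀ {p} (G : Graph (suc p)) → ∑[ a < p ] edge G zero (suc a) ≡ deg G zero
deg-zero {p} G = sym (trans (deg≡∑ G zero) (cong (_+ ∑[ a < p ] edge G zero (suc a)) (edge-irrefl G zero)))

-- The first vertices of G₁ and G₂ are merged into the hub.
module Glue {p q} (G₁ : Graph (suc p)) (G₂ : Graph (suc q)) where

  data Part : Set where
    hub : Part
    left : Fin p → Part
    right : Fin q → Part

  part : Fin (suc (p + q)) → Part
  part zero = hub
  part (suc k) = [ left , right ]′ (splitAt p k)

  adjPart : Part → Part → Bool
  adjPart hub hub = false
  adjPart hub (left b) = adj G₁ zero (suc b)
  adjPart hub (right b) = adj G₂ zero (suc b)
  adjPart (left a) hub = adj G₁ (suc a) zero
  adjPart (left a) (left b) = adj G₁ (suc a) (suc b)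
  adjPart (left a) (right b) = false
  adjPart (right a) hub = adj G₂ (suc a) zero
  adjPart (right a) (left b) = false
  adjPart (right a) (right b) = adj G₂ (suc a) (suc b)

  adjPart-sym : ∀ s t → adjPart s t ≡ adjPart t s
  adjPart-sym hub hub = refl
  adjPart-sym hub (left b) = adj-sym G₁ _ _
  adjPart-sym hub (right b) = adj-sym G₂ _ _
  adjPart-sym (left a) hub = adj-sym G₁ _ _
  adjPart-sym (left a) (left b) = adj-sym G₁ _ _
  adjPart-sym (left a) (right b) = refl
  adjPart-sym (right a) hub = adj-sym G₂ _ _
  adjPart-sym (right a) (left b) = refl
  adjPart-sym (right a) (right b) = adj-sym G₂ _ _

  adjPart-irrefl : ∀ s → adjPart s s ≡ false
  adjPart-irrefl hub = refl
  adjPart-irrefl (left a) = irrefl G₁ _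
  adjPart-irrefl (right a) = irrefl G₂ _

  glue : Graph (suc (p + q))
  glue = record
    { adj = λ i j → adjPart (part i) (part j)
    ; sym = λ i j → adjPart-sym (part i) (part j)
    ; irrefl = λ i → adjPart-irrefl (part i)
    }

  degPart : Part → ℕ
  degPart hub = deg G₁ zero + deg G₂ zero
  degPart (left a) = deg G₁ (suc a)
  degPart (right b) = deg G₂ (suc b)

  deg-glue : ∀ i → deg glue i ≡ degPart (part i)
  deg-glue i = trans (deg≡∑ glue i)
    (trans (cong (edgePart s hub +_) (∑-splitAt p (edgePart s ∘ [ left , right ]′))) (byPart s))
    where
    s : Part
    s = part i
    edgePart : Part → Part → ℕ
    edgePart s t = if adjPart s t then 1 else 0
    byPart : ∀ s → edgePart s hub + (∑[ a < p ] edgePart s (left a) + ∑[ b < q ] edgePart s (right b)) ≡ degPart s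
    byPart hub = cong₂ _+_ (deg-zero G₁) (deg-zero G₂)
    byPart (left a) = trans
      (cong (λ t → edge G₁ (suc a) zero + (∑[ b < p ] edge G₁ (suc a) (suc b) + t)) (sum-replicate-zero q))
      (trans (cong (edge G₁ (suc a) zero +_) (+-identityʳ _)) (sym (deg≡∑ G₁ (suc a))))
    byPart (right b) = trans
      (cong (λ t → edge G₂ (suc b) zero + (t + ∑[ c < q ] edge G₂ (suc b) (suc c))) (sum-replicate-zero p))
      (sym (deg≡∑ G₂ (suc b)))

  IsLeft : Part → Set
  IsLeft (left _) = ⊤
  IsLeft _ = ⊥

  avoiding-hub-stays-left : ∀ {i j} → ReachIn glue (λ w → w ≢ zero) i j → IsLeft (part i) → IsLeft (part j)
  avoiding-hub-stays-left here isLeft = isLeft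
  avoiding-hub-stays-left {i} (step {w = w} e w≢0 r) isLeft = avoiding-hub-stays-left r (next (part i) w e w≢0 isLeft)
    where
    next : ∀ s w → adjPart s (part w) ≡ true → w ≢ zero → IsLeft s → IsLeft (part w)
    next s zero e w≢0 _ = ⊥-elim (w≢0 refl)
    next (left a) (suc k) e _ _ with splitAt p k
    ... | inj₁ _ = tt
    ... | inj₂ _ = case e of λ ()

  hub-separates : (a : Fin p) (b : Fin q) → Separates glue zero (suc (a ↑ˡ q)) (suc (p ↑ʳ b))
  hub-separates a b = (λ ()) , (λ ()) , λ r → subst IsLeft (cong [ left , right ]′ (Finₚ.splitAt-↑ʳ p q b))
    (avoiding-hub-stays-left r (subst IsLeft (cong [ left , right ]′ (sym (Finₚ.splitAt-↑ˡ p a q))) tt))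

glue-cutVertex : ∀ {a b c xs ys} → Graphical (a ∷ xs) → Graphical (b ∷ ys) → a + b ≡ c →
  1 ≤ length xs → 1 ≤ length ys → PotentiallyP HasCutVertex (c ∷ xs ++ ys)
glue-cutVertex {a} {b} {c} {xs} {ys} (G₁ , R₁) (G₂ , R₂) a+b≡c 1≤p 1≤q =
  subst (PotentiallyP HasCutVertex) listed
    (relabel π glue , realizes-tabulate {G = glue} degrees ,
     cutVertex-relabel π (zero , _ , _ , hub-separates (Fin.fromℕ< 1≤p) (Fin.fromℕ< 1≤q)))
  where
  open Glue G₁ G₂
  value : Part → ℕ
  value hub = c
  value (left i) = lookup xs i
  value (right j) = lookup ys j
  π : Fin (suc (length xs + length ys)) ↔ Fin (length (tabulate (value ∘ part)))
  π = tabulate-indices (value ∘ part)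
  degrees : ∀ i → deg glue i ≡ value (part i)
  degrees i = trans (deg-glue i) (byPart (part i))
    where
    byPart : ∀ s → degPart s ≡ value s
    byPart hub = trans (cong₂ _+_ (R₁ zero) (R₂ zero)) a+b≡c
    byPart (left i) = R₁ (suc i)
    byPart (right j) = R₂ (suc j)
  listed : tabulate (value ∘ part) ≡ c ∷ xs ++ ys
  listed = cong (c ∷_) (trans (tabulate-splitAt (length xs) (value ∘ [ left , right ]′))
    (cong₂ _++_ (tabulate-lookup xs) (tabulate-lookup ys)))

removeOne-head : ∀ a C → removeOne a (a ∷ C) ≡ C
removeOne-head a C with a ≟ a
... | yes _ = refl
... | no a≢a = ⊥-elim (a≢a refl)

removeOne-∈ : ∀ {a B} → a ∈ B → B ↭ a ∷ removeOne a B
removeOne-∈ {a} {x ∷ B} a∈ with a ≟ x | a∈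
... | yes refl | _ = ↭-refl
... | no a≢x | here a≡x = ⊥-elim (a≢x a≡x)
... | no _ | there a∈B = ↭-trans (prep x (removeOne-∈ a∈B)) (swap x a ↭-refl)

removeOne-∉ : ∀ {a B} → a ∉ B → removeOne a B ≡ B
removeOne-∉ {a} {[]} _ = refl
removeOne-∉ {a} {x ∷ B} a∉ with a ≟ x
... | yes refl = ⊥-elim (a∉ (here refl))
... | no _ = cong (x ∷_) (removeOne-∉ (a∉ ∘ there))

removeOne-++ : ∀ {a} A C → a ∉ A → removeOne a (A ++ C) ≡ A ++ removeOne a C
removeOne-++ [] C _ = refl
removeOne-++ {a} (x ∷ A) C a∉ with a ≟ x
... | yes refl = ⊥-elim (a∉ (here refl))
... | no _ = cong (x ∷_) (removeOne-++ A C (a∉ ∘ there))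

removeOne-↭ : ∀ {a B C} → B ↭ C → removeOne a B ↭ removeOne a C
removeOne-↭ {a} {B} B↭C with a ∈? B
... | yes a∈B = drop-∷ (↭-trans (↭-sym (removeOne-∈ a∈B)) (↭-trans B↭C (removeOne-∈ (∈-resp-↭ B↭C a∈B))))
... | no a∉B = subst₂ _↭_ (sym (removeOne-∉ a∉B)) (sym (removeOne-∉ (a∉B ∘ ∈-resp-↭ (↭-sym B↭C)))) B↭C

∖ₘ-↭ : ∀ {B C} A → B ↭ C → B ∖ₘ A ↭ C ∖ₘ A
∖ₘ-↭ [] p = p
∖ₘ-↭ (a ∷ A) p = ∖ₘ-↭ A (removeOne-↭ p)

++-∖ₘ : ∀ A C → (A ++ C) ∖ₘ A ≡ C
++-∖ₘ [] C = refl
++-∖ₘ (a ∷ A) C rewrite removeOne-head a (A ++ C) = ++-∖ₘ A C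

∖ₘ-cancel : ∀ {B} A {C} → B ↭ A ++ C → B ∖ₘ A ↭ C
∖ₘ-cancel A {C} p = subst (_ ↭_) (++-∖ₘ A C) (∖ₘ-↭ A p)

⊆ₘ⇒↭ : ∀ {A B} → A ⊆ₘ B → B ↭ A ++ (B ∖ₘ A)
⊆ₘ⇒↭ {A} (_ , p) = ↭-trans p (++⁺ˡ A (↭-sym (∖ₘ-cancel A p)))

length-removeOne≤ : ∀ a xs → length (removeOne a xs) ≤ length xs
length-removeOne≤ a [] = z≤n
length-removeOne≤ a (x ∷ xs) with a ≟ x
... | yes _ = n≤1+n _
... | no _ = s≤s (length-removeOne≤ a xs)

⊆ₘ⇒length≤ : ∀ {A B} → A ⊆ₘ B → length A ≤ length B
⊆ₘ⇒length≤ {A} (rest , B↭) = subst (length A ≤_) (sym (trans (↭-length B↭) (length-++ A))) (m≤m+n _ _)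

filter-partition-↭ : ∀ {A : Set} {P : A → Set} (P? : ∀ a → Dec (P a)) xs →
  xs ↭ filter P? xs ++ filter (¬? ∘ P?) xs
filter-partition-↭ P? [] = ↭-refl
filter-partition-↭ P? (x ∷ xs) with P? x
... | yes _ = prep x (filter-partition-↭ P? xs)
... | no _ = ↭-trans (prep x (filter-partition-↭ P? xs)) (↭-sym (shift x (filter P? xs) _))

filter-++-all : ∀ {A : Set} {P : A → Set} (P? : ∀ a → Dec (P a)) {xs ys} → All P xs →
  filter P? (xs ++ ys) ≡ xs ++ filter P? ys
filter-++-all P? {xs} {ys} all = trans (filter-++ P? xs ys) (cong (_++ filter P? ys) (filter-all P? all))

witness-⊆ₘ : ∀ ds d s sL → d ∈ ds → sL ⊆ₘ dL ds d s → (d ∷ sL) ⊆ₘ ds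
witness-⊆ₘ ds d s sL d∈ds (rest , p) with d ≤? s
... | yes d≤s = rest ++ high , ↭-trans (filter-partition-↭ (_≤? s) ds)
        (↭-trans (++⁺ʳ high (↭-trans (removeOne-∈ (∈-filter⁺ (_≤? s) d∈ds d≤s)) (prep d p)))
        (↭-reflexive (cong (d ∷_) (++-assoc sL rest high))))
  where
  high : List ℕ
  high = filter (¬? ∘ (_≤? s)) ds
... | no d≰s = rest ++ removeOne d high , ↭-trans (filter-partition-↭ (_≤? s) ds)
        (↭-trans (++⁺ (subst (_↭ sL ++ rest) (removeOne-∉ d∉low) p) (removeOne-∈ d∈high))
        (↭-trans (shift d (sL ++ rest) _) (↭-reflexive (cong (d ∷_) (++-assoc sL rest _)))))
  where
  high : List ℕ
  high = filter (¬? ∘ (_≤? s)) ds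
  d∉low : d ∉ filter (_≤? s) ds
  d∉low d∈ = d≰s (proj₂ (∈-filter⁻ (_≤? s) {xs = ds} d∈))
  d∈high : d ∈ high
  d∈high = ∈-filter⁺ (¬? ∘ (_≤? s)) d∈ds d≰s

small-⊆ₘ-dL : ∀ {ds d small large} s → ds ↭ d ∷ small ++ large → All (_≤ s) small → small ⊆ₘ dL ds d s
small-⊆ₘ-dL {ds} {d} {small} {large} s ds↭ small≤s with d ≤? s
... | yes d≤s = filter (_≤? s) large , ↭-trans (removeOne-↭ (filter-↭ (_≤? s) ds↭))
  (↭-reflexive (trans
    (cong (removeOne d) (trans (filter-accept (_≤? s) d≤s) (cong (d ∷_) (filter-++-all (_≤? s) small≤s))))
    (removeOne-head d _)))
... | no d≰s = removeOne d (filter (_≤? s) large) , ↭-trans (removeOne-↭ (filter-↭ (_≤? s) ds↭))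
  (↭-reflexive (trans (cong (removeOne d) (trans (filter-reject (_≤? s) d≰s) (filter-++-all (_≤? s) small≤s)))
    (removeOne-++ small _ (d≰s ∘ All.lookup small≤s))))

zeroFree⇒last≥1 : ∀ {ds} → ZeroFree ds → ds ≢ [] → 1 ≤ ds ! length ds
zeroFree⇒last≥1 {[]} _ []≢[] = ⊥-elim ([]≢[] refl)
zeroFree⇒last≥1 {x ∷ []} (1≤x ∷ _) _ = 1≤x
zeroFree⇒last≥1 {x ∷ y ∷ ds} (_ ∷ zf) _ = zeroFree⇒last≥1 zf (λ ())

nonIncreasing-tail : ∀ {a t} → NonIncreasing (a ∷ t) → NonIncreasing t
nonIncreasing-tail {t = []} _ = []
nonIncreasing-tail {t = _ ∷ _} (_ ∷ ni) = ni

last≤ : ∀ {ds a} → NonIncreasing ds → a ∈ ds → ds ! length ds ≤ a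
last≤ {_ ∷ []} _ (here refl) = ≤-refl
last≤ {_ ∷ _ ∷ _} (b≤a ∷ ni) (here refl) = ≤-trans (last≤ ni (here refl)) b≤a
last≤ {_ ∷ _ ∷ _} (_ ∷ ni) (there a∈) = last≤ ni a∈

!≤head : ∀ {a t} → NonIncreasing (a ∷ t) → ∀ j → (a ∷ t) ! j ≤ a
!≤head ni zero = z≤n
!≤head ni (suc zero) = ≤-refl
!≤head {t = []} ni (suc (suc j)) = z≤n
!≤head {t = _ ∷ _} (b≤a ∷ ni) (suc (suc j)) = ≤-trans (!≤head ni (suc j)) b≤a

suffix≤ : ∀ {ds} s → NonIncreasing ds → s ≤ length (filter (_≤? s) ds) → ds ! (length ds ∸ s + 1) ≤ s
suffix≤ {[]} s _ _ = z≤n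
suffix≤ {a ∷ t} s ni many with a ≤? s
... | yes a≤s = ≤-trans (!≤head ni (suc (length t) ∸ s + 1)) a≤s
... | no a≰s = subst (λ j → (a ∷ t) ! j ≤ s) (sym index)
  (subst (λ j → t ! j ≤ s) (+-comm (length t ∸ s) 1) (suffix≤ s (nonIncreasing-tail ni) many′))
  where
  many′ : s ≤ length (filter (_≤? s) t)
  many′ = subst (λ l → s ≤ length l) (filter-reject (_≤? s) a≰s) many
  index : suc (length t) ∸ s + 1 ≡ suc (suc (length t ∸ s))
  index = trans (cong (_+ 1) (+-∸-assoc 1 (≤-trans many′ (length-filter (_≤? s) t))))
    (cong suc (+-comm (length t ∸ s) 1))

second≤ : ∀ {ds d rest} B → NonIncreasing ds → ds ↭ d ∷ rest → All (_≤ B) rest → ds ! 2 ≤ B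
second≤ {ds} {d} {rest} B ni ds↭ rest≤B = second ni atMostOneLarge
  where
  Large? : ∀ a → Dec (¬ a ≤ B)
  Large? a = ¬? (a ≤? B)
  atMostOneLarge : length (filter Large? ds) ≤ 1
  atMostOneLarge = subst (_≤ 1) (sym (↭-length (filter-↭ Large? ds↭)))
    (count-cons (filter-none Large? (All.map (λ a≤B a≰B → a≰B a≤B) rest≤B)))
    where
    count-cons : filter Large? rest ≡ [] → length (filter Large? (d ∷ rest)) ≤ 1
    count-cons none with Large? d
    ... | yes large = subst (λ l → length l ≤ 1) (sym (trans (filter-accept Large? large) (cong (d ∷_) none))) ≤-refl
    ... | no ¬large = subst (λ l → length l ≤ 1) (sym (trans (filter-reject Large? ¬large) none)) z≤n
  second : ∀ {ds} → NonIncreasing ds → length (filter Large? ds) ≤ 1 → ds ! 2 ≤ B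
  second {[]} _ _ = z≤n
  second {_ ∷ []} _ _ = z≤n
  second {a ∷ b ∷ t} (b≤a ∷ _) count with b ≤? B
  ... | yes b≤B = b≤B
  ... | no b≰B
      with subst (λ l → length l ≤ 1) (trans (filter-accept Large? a≰B) (cong (a ∷_) (filter-accept Large? b≰B))) count
    where
    a≰B : ¬ a ≤ B
    a≰B a≤B = b≰B (≤-trans b≤a a≤B)
  ...   | s≤s ()

first≡⊎≤ : ∀ {ds d rest} B → ds ↭ d ∷ rest → All (_≤ B) rest → (d ≡ ds ! 1) ⊎ (ds ! 1 ≤ B)
first≡⊎≤ {[]} _ _ _ = inj₂ z≤n
first≡⊎≤ {a ∷ _} _ ds↭ rest≤B with ∈-resp-↭ ds↭ (here refl)
... | here a≡d = inj₁ (sym a≡d)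
... | there a∈rest = inj₂ (All.lookup rest≤B a∈rest)

m≤n/2⇒m+m≤n : ∀ m n → m ≤ n / 2 → m + m ≤ n
m≤n/2⇒m+m≤n m n h = subst (_≤ n) (sym (m+m≡m*2 m)) (≤-trans (*-monoˡ-≤ 2 h) (m/n*n≤m n 2))

m+m≤n⇒m≤n/2 : ∀ m n → m + m ≤ n → m ≤ n / 2
m+m≤n⇒m≤n/2 m n h = subst (_≤ n / 2) (m*n/n≡m m 2) (/-monoˡ-≤ 2 (subst (_≤ n) (m+m≡m*2 m) h))

WitnessΣ : List ℕ → Set
WitnessΣ ds = Σ ℕ λ d → Σ ℕ λ s → Σ (List ℕ) λ sL → Σ ℕ λ d' → Witness ds d s sL d'

witness⇒cutVertex : ∀ {ds} → ZeroFree ds → WitnessΣ ds → PotentiallyP HasCutVertex ds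
witness⇒cutVertex {ds} zf
  (d , s , sL , d' , d∈ds , dₙ≤s , s≤half , _ , _ , _ , |sL|≡s , sL⊆ , _ , d'≤d∸1 , _ , low , _ , high) =
  cutVertex-↭ (↭-sym split) (glue-cutVertex low high d'+[d∸d']≡d 1≤|sL| 1≤|rest|)
  where
  rest : List ℕ
  rest = ds ∖ₘ (d ∷ sL)
  split : ds ↭ d ∷ sL ++ rest
  split = ⊆ₘ⇒↭ (witness-⊆ₘ ds d s sL d∈ds sL⊆)
  d'+[d∸d']≡d : d' + (d ∸ d') ≡ d
  d'+[d∸d']≡d = m+[n∸m]≡n (≤-trans d'≤d∸1 (m∸n≤m d 1))
  1≤s : 1 ≤ s
  1≤s = ≤-trans (zeroFree⇒last≥1 zf (λ { refl → case d∈ds of λ () })) dₙ≤s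
  1≤|sL| : 1 ≤ length sL
  1≤|sL| = subst (1 ≤_) (sym |sL|≡s) 1≤s
  |ds|≡ : length ds ≡ suc (s + length rest)
  |ds|≡ = trans (↭-length split) (cong suc (trans (length-++ sL) (cong (_+ length rest) |sL|≡s)))
  s≤|rest| : s ≤ length rest
  s≤|rest| = +-cancelˡ-≤ s s (length rest)
    (subst (s + s ≤_) (cong (_∸ 1) |ds|≡) (m≤n/2⇒m+m≤n s (length ds ∸ 1) s≤half))
  1≤|rest| : 1 ≤ length rest
  1≤|rest| = ≤-trans 1≤s s≤|rest|

cutVertex⇒¬forciblyBiconnected : ∀ {ds} → PotentiallyP HasCutVertex ds → ¬ ForciblyP Biconnected ds
cutVertex⇒¬forciblyBiconnected (G , R , cut) biconnected = cutVertex⇒¬biconnected cut (biconnected G R)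

forciblyBiconnected⇒¬witness : ∀ {ds} → ZeroFree ds → ForciblyP Biconnected ds → ¬ WitnessΣ ds
forciblyBiconnected⇒¬witness {ds} zf biconnected w =
  cutVertex⇒¬forciblyBiconnected {ds} (witness⇒cutVertex zf w) biconnected

-- Reachability avoiding a vertex is decidable

does⇒ : ∀ {A : Set} (a? : Dec A) → does a? ≡ true → A
does⇒ (yes a) _ = a

module Reachability {n} (G : Graph n) {ok : Fin n → Set} (ok? : Decidable ok) (u : Fin n) where

  Within : ℕ → Fin n → Set
  Within zero v = u ≡ v
  Within (suc k) v = Within k v ⊎ Σ (Fin n) λ c → Within k c × adj G c v ≡ true × ok v

  within? : ∀ k → Decidable (Within k)
  within? zero v = u Finₚ.≟ v
  within? (suc k) v = within? k v ⊎-dec Finₚ.any? (λ c → within? k c ×-dec ((adj G c v Boolₚ.≟ true) ×-dec ok? v))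

  within⇒reach : ∀ k {v} → Within k v → ReachIn G ok u v
  within⇒reach zero refl = here
  within⇒reach (suc k) (inj₁ w) = within⇒reach k w
  within⇒reach (suc k) (inj₂ (c , w , e , o)) = ReachIn-snoc (within⇒reach k w) e o

  within-start : ∀ k → Within k u
  within-start zero = refl
  within-start (suc k) = inj₁ (within-start k)

  Closed : ℕ → Set
  Closed k = ∀ v → Within (suc k) v → Within k v

  closed⇒reach⇒within : ∀ {k} → Closed k → ∀ {a b} → ReachIn G ok a b → Within k a → Within k b
  closed⇒reach⇒within closed here w = w
  closed⇒reach⇒within closed (step {w = c} e o r) w = closed⇒reach⇒within closed r (closed c (inj₂ (_ , w , e , o)))

  ball : ℕ → Subset n
  ball k = Vec.tabulate (λ v → does (within? k v))

  ∈-ball⁺ : ∀ {k v} → Within k v → v ∈ₛ ball k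
  ∈-ball⁺ {k} {v} w = lookup⇒[]= v (ball k) (trans (lookup∘tabulate _ v) (dec-true (within? k v) w))

  ∈-ball⁻ : ∀ {k v} → v ∈ₛ ball k → Within k v
  ∈-ball⁻ {k} {v} m = does⇒ (within? k v) (trans (sym (lookup∘tabulate _ v)) ([]=⇒lookup m))

  ¬closed⇒ball⊂ : ∀ k → ¬ Closed k → ball k ⊂ ball (suc k)
  ¬closed⇒ball⊂ k ¬closed with Finₚ.¬∀⟶∃¬ n _ (λ v → within? (suc k) v →-dec within? k v) ¬closed
  ... | v , ¬imp = (∈-ball⁺ ∘ inj₁ ∘ ∈-ball⁻) , v ,
    ∈-ball⁺ (decidable-stable (within? (suc k) v) (λ ¬w → ¬imp (⊥-elim ∘ ¬w))) ,
    (λ m → ¬imp (λ _ → ∈-ball⁻ m))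

  -- The balls grow strictly until the iteration is closed, and never exceed n vertices.
  closure : Σ ℕ Closed
  closure = search n 0 (m≤n+m n ∣ ball 0 ∣)
    where
    search : ∀ fuel k → n ≤ ∣ ball k ∣ + fuel → Σ ℕ Closed
    search fuel k n≤ with Finₚ.all? (λ v → within? (suc k) v →-dec within? k v)
    ... | yes closed = k , closed
    ... | no ¬closed with p⊂q⇒∣p∣<∣q∣ (¬closed⇒ball⊂ k ¬closed) | fuel
    ...   | grows | zero = ⊥-elim (<⇒≱ (≤-trans grows (∣p∣≤n (ball (suc k)))) (subst (n ≤_) (+-identityʳ _) n≤))
    ...   | grows | suc fuel = search fuel (suc k)
      (≤-trans n≤ (subst (_≤ ∣ ball (suc k) ∣ + fuel) (sym (+-suc _ fuel)) (+-monoˡ-≤ fuel grows)))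

  reachable? : Decidable (ReachIn G ok u)
  reachable? v with closure
  ... | k , closed with within? k v
  ...   | yes w = yes (within⇒reach k w)
  ...   | no ¬w = no (λ r → ¬w (closed⇒reach⇒within closed r (within-start k)))

-- Separations at a cut vertex

unique-↭ : ∀ {n} {x : Fin n} {xs} → Unique xs → x ∈ xs → xs ↭ x ∷ filter (λ y → ¬? (y Finₚ.≟ x)) xs
unique-↭ {x = x} {_ ∷ ys} (x∉ys ∷ _) (here refl) = ↭-reflexive (cong (x ∷_) (sym
  (trans (filter-reject (λ y → ¬? (y Finₚ.≟ x)) (λ x≢x → x≢x refl))
         (filter-all (λ y → ¬? (y Finₚ.≟ x)) (All.map (λ x≢y y≡x → x≢y (sym y≡x)) x∉ys)))))
unique-↭ {x = x} {y ∷ ys} (y∉ys ∷ uniq) (there x∈ys) = subst (y ∷ ys ↭_) (cong (x ∷_) (sym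
  (filter-accept (λ z → ¬? (z Finₚ.≟ x)) (All.lookup y∉ys x∈ys))))
  (↭-trans (prep y (unique-↭ uniq x∈ys)) (swap y x ↭-refl))

record Separation {n} (G : Graph n) (x : Fin n) : Set where
  field
    left right : List (Fin n)
    vertices : allFin n ↭ x ∷ left ++ right
    no-crossing : ∀ {a b} → a ∈ left → b ∈ right → adj G a b ≡ false
    leftVertex : Σ (Fin n) (_∈ left)
    rightVertex : Σ (Fin n) (_∈ right)

swapSides : ∀ {n} {G : Graph n} {x} → Separation G x → Separation G x
swapSides {G = G} S = record
  { left = right
  ; right = left
  ; vertices = ↭-trans vertices (prep _ (++-comm left right))
  ; no-crossing = λ a∈ b∈ → trans (adj-sym G _ _) (no-crossing b∈ a∈)
  ; leftVertex = rightVertex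
  ; rightVertex = leftVertex
  }
  where open Separation S

separates⇒separation : ∀ {n} {G : Graph n} {x u v} → Separates G x u v → Separation G x
separates⇒separation {n} {G} {x} {u} {v} (u≢x , v≢x , ¬reach) = record
  { left = filter reach? others
  ; right = filter (¬? ∘ reach?) others
  ; vertices = ↭-trans (unique-↭ (allFin⁺ n) (∈-allFin x)) (prep x (filter-partition-↭ reach? others))
  ; no-crossing = no-crossing
  ; leftVertex = u , ∈-filter⁺ reach? (∈-others u≢x) here
  ; rightVertex = v , ∈-filter⁺ (¬? ∘ reach?) (∈-others v≢x) ¬reach
  }
  where
  avoid? : ∀ w → Dec (w ≢ x)
  avoid? w = ¬? (w Finₚ.≟ x)
  open Reachability G avoid? u renaming (reachable? to reach?)
  others : List (Fin n)
  others = filter avoid? (allFin n)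
  ∈-others : ∀ {w} → w ≢ x → w ∈ others
  ∈-others w≢x = ∈-filter⁺ avoid? (∈-allFin _) w≢x
  no-crossing : ∀ {a b} → a ∈ filter reach? others → b ∈ filter (¬? ∘ reach?) others → adj G a b ≡ false
  no-crossing {a} {b} a∈ b∈ with adj G a b in e
  ... | false = refl
  ... | true = ⊥-elim (¬reach-b (ReachIn-snoc reach-a e b≢x))
    where
    reach-a : ReachIn G (λ w → w ≢ x) u a
    reach-a = proj₂ (∈-filter⁻ reach? {xs = others} a∈)
    ¬reach-b : ¬ ReachIn G (λ w → w ≢ x) u b
    ¬reach-b = proj₂ (∈-filter⁻ (¬? ∘ reach?) {xs = others} b∈)
    b≢x : b ≢ x
    b≢x = proj₂ (∈-filter⁻ avoid? {xs = allFin n} (proj₁ (∈-filter⁻ (¬? ∘ reach?) {xs = others} b∈)))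

SmallLeft : ∀ {n} → Graph n → Fin n → Set
SmallLeft G x = Σ (Separation G x) λ S → length (Separation.left S) ≤ length (Separation.right S)

smallLeft : ∀ {n} {G : Graph n} {x} → Separation G x → SmallLeft G x
smallLeft S with ≤-total (length left) (length right)
  where open Separation S
... | inj₁ small = S , small
... | inj₂ large = swapSides S , large

module SeparationDegrees {n} {G : Graph n} {x} (S : Separation G x) where
  open Separation S

  deg-split : ∀ w → deg G w ≡ edge G w x + (edgesTo G w left + edgesTo G w right)
  deg-split w = trans (sum-↭ (map⁺ (edge G w) vertices))
    (cong (edge G w x +_) (trans (cong sum (map-++ (edge G w) left right)) (sum-++ (map (edge G w) left) _)))

  deg-left : ∀ {w} → w ∈ left → deg G w ≡ edge G w x + edgesTo G w left
  deg-left {w} w∈ = trans (deg-split w)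
    (cong (edge G w x +_) (trans (cong (edgesTo G w left +_) (sum-map-≡0 no-edge)) (+-identityʳ _)))
    where
    no-edge : All (λ v → edge G w v ≡ 0) right
    no-edge = All.tabulate (λ v∈ → cong (λ b → if b then 1 else 0) (no-crossing w∈ v∈))

  deg-left≤ : ∀ {w} → w ∈ left → deg G w ≤ length left
  deg-left≤ {w} w∈ = subst (_≤ length left) (sym (deg-left w∈))
    (≤-trans (+-monoˡ-≤ _ (edge≤1 G w x)) (sum-map-< left (edge≤1 G w) w∈ (edge-irrefl G w)))

  deg-cut : deg G x ≡ edgesTo G x left + edgesTo G x right
  deg-cut = trans (deg-split x) (cong (_+ (edgesTo G x left + edgesTo G x right)) (edge-irrefl G x))

  cut∉left : x ∉ left
  cut∉left = Unique[x∷xs]⇒x∉xs (Unique-resp-↭ (≡.setoid (Fin n)) (↭⇒↭ₛ vertices) (allFin⁺ n)) ∘ ∈-++⁺ˡ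

  left-neighbour : AllReachable G → Σ (Fin n) λ p → p ∈ left × adj G x p ≡ true
  left-neighbour connected
    with ReachIn-exit (λ w → Any.any? (w Finₚ.≟_) left) (connected (proj₁ leftVertex) x) (proj₂ leftVertex) cut∉left
  ... | p , q , p∈ , q∉ , e with ∈-resp-↭ vertices (∈-allFin q)
  ...   | here refl = p , p∈ , trans (adj-sym G x p) e
  ...   | there q∈sides with ∈-++⁻ left q∈sides
  ...     | inj₁ q∈left = ⊥-elim (q∉ q∈left)
  ...     | inj₂ q∈right = case trans (sym e) (no-crossing p∈ q∈right) of λ ()

  1≤edgesTo-left : AllReachable G → 1 ≤ edgesTo G x left
  1≤edgesTo-left connected with left-neighbour connected
  ... | p , p∈ , e = ≤-trans (subst (λ b → 1 ≤ (if b then 1 else 0)) (sym e) ≤-refl) (sum-map-∈ p∈)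

  graphical-left : Graphical (edgesTo G x left ∷ map (deg G) left)
  graphical-left = subst Graphical (cong₂ _∷_ (cong (_+ edgesTo G x left) (edge-irrefl G x))
      (map-cong-local (All.tabulate (sym ∘ deg-left))))
    (induced-graphical G (x ∷ left))

degrees-↭ : ∀ {ds} {G : Graph (length ds)} {x} → Realizes ds G → (S : Separation G x) →
  ds ↭ deg G x ∷ map (deg G) (Separation.left S) ++ map (deg G) (Separation.right S)
degrees-↭ {ds} {G} {x} R S = subst (_↭ deg G x ∷ map (deg G) left ++ map (deg G) right) (realizes⇒map-deg≡ {ds} {G} R)
  (↭-trans (map⁺ (deg G) vertices) (↭-reflexive (cong (deg G x ∷_) (map-++ (deg G) left right))))
  where open Separation S

module CutWitness {ds} (ni : NonIncreasing ds) {G : Graph (length ds)} (R : Realizes ds G)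
  (connected : AllReachable G) {x} (S : Separation G x)
  (small : length (Separation.left S) ≤ length (Separation.right S)) where

  open Separation S
  module L = SeparationDegrees S
  module H = SeparationDegrees (swapSides S)

  n s h d d' d'' : ℕ
  n = length ds
  s = length left
  h = length right
  d = deg G x
  d' = edgesTo G x left
  d'' = edgesTo G x right

  sL sH : List ℕ
  sL = map (deg G) left
  sH = map (deg G) right

  split : ds ↭ d ∷ sL ++ sH
  split = degrees-↭ R S

  |sL|≡s : length sL ≡ s
  |sL|≡s = length-map (deg G) left

  n≡ : n ≡ suc (s + h)
  n≡ = trans (↭-length split) (cong suc (trans (length-++ sL) (cong₂ _+_ |sL|≡s (length-map (deg G) right))))

  n∸s∸1≡h : n ∸ s ∸ 1 ≡ h
  n∸s∸1≡h = trans (cong (λ m → m ∸ s ∸ 1) n≡)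
    (cong (_∸ 1) (trans (+-∸-assoc 1 (m≤m+n s h)) (cong suc (m+n∸m≡n s h))))

  sL≤s : All (_≤ s) sL
  sL≤s = All-map⁺ (All.tabulate L.deg-left≤)

  others≤h : All (_≤ h) (sL ++ sH)
  others≤h = All-++⁺ (All.map (λ ≤s → ≤-trans ≤s small) sL≤s) (All-map⁺ (All.tabulate H.deg-left≤))

  sL⊆ : sL ⊆ₘ dL ds d s
  sL⊆ = small-⊆ₘ-dL s split sL≤s

  dₙ≤s : ds ! n ≤ s
  dₙ≤s = ≤-trans (last≤ ni (subst (_∈ ds) (sym (R u)) (∈-lookup u))) (L.deg-left≤ u∈left)
    where open Σ leftVertex renaming (proj₁ to u; proj₂ to u∈left)

  s≤half : s ≤ (n ∸ 1) / 2
  s≤half = m+m≤n⇒m≤n/2 s (n ∸ 1) (subst (s + s ≤_) (sym (cong (_∸ 1) n≡)) (+-monoʳ-≤ s small))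

  d₂≤h : ds ! 2 ≤ h
  d₂≤h = second≤ h ni split others≤h

  d≡ : d ≡ d' + d''
  d≡ = L.deg-cut

  d∸d'≡d'' : d ∸ d' ≡ d''
  d∸d'≡d'' = trans (cong (_∸ d') d≡) (m+n∸m≡n d' d'')

  d'≤d∸1 : d' ≤ d ∸ 1
  d'≤d∸1 = subst (d' ≤_) (sym (trans (cong (_∸ 1) d≡) (+-∸-assoc d' (H.1≤edgesTo-left connected))))
    (m≤m+n d' (d'' ∸ 1))

  many≤s : s ≤ length (filter (_≤? s) ds)
  many≤s = ≤-trans (≤-reflexive (sym |sL|≡s)) (≤-trans (⊆ₘ⇒length≤ sL⊆) (length-removeOne≤ d (filter (_≤? s) ds)))

  highGraphical : Graphical ((d ∸ d') ∷ (ds ∖ₘ (d ∷ sL)))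
  highGraphical = graphical-↭ (subst (λ t → d'' ∷ sH ↭ t ∷ (ds ∖ₘ (d ∷ sL))) (sym d∸d'≡d'')
    (prep d'' (↭-sym (∖ₘ-cancel (d ∷ sL) split)))) H.graphical-left

  witness : Witness ds d s sL d'
  witness = ∈-resp-↭ (↭-sym split) (here refl)
          , dₙ≤s
          , s≤half
          , suffix≤ s ni many≤s
          , subst (ds ! 2 ≤_) (sym n∸s∸1≡h) d₂≤h
          , Sum.map₂ (subst (ds ! 1 ≤_) (sym n∸s∸1≡h)) (first≡⊎≤ h split others≤h)
          , |sL|≡s
          , sL⊆
          , L.1≤edgesTo-left connected
          , d'≤d∸1
          , graphical⇒even {d' ∷ sL} L.graphical-left , L.graphical-left
          , graphical⇒even {(d ∸ d') ∷ (ds ∖ₘ (d ∷ sL))} highGraphical , highGraphical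

  d₂+dₙ<n : ds ! 2 + ds ! n < n
  d₂+dₙ<n = subst (ds ! 2 + ds ! n <_) (sym n≡)
    (s≤s (subst (ds ! 2 + ds ! n ≤_) (+-comm h s) (+-mono-≤ d₂≤h dₙ≤s)))

cutVertex⇒witness : ∀ {ds} {G : Graph (length ds)} → NonIncreasing ds → Realizes ds G →
  AllReachable G → HasCutVertex G → (ds ! 2 + ds ! length ds < length ds) × WitnessΣ ds
cutVertex⇒witness {ds} {G} ni R connected (x , _ , _ , sep) =
  fromSmallLeft (smallLeft (separates⇒separation sep))
  where
  fromSmallLeft : SmallLeft G x → (ds ! 2 + ds ! length ds < length ds) × WitnessΣ ds
  fromSmallLeft (S , small) = d₂+dₙ<n , d , s , sL , d' , witness
    where open CutWitness ni R connected S small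

conditions⇒forciblyBiconnected : ∀ {ds} → NonIncreasing ds → PotentiallyP Biconnected ds → ForciblyP Connected ds →
  (ds ! 2 + ds ! length ds ≥ length ds) ⊎ ¬ WitnessΣ ds → ForciblyP Biconnected ds
conditions⇒forciblyBiconnected {ds} ni (_ , _ , (_ , 3≤n , _)) connected excluded G R = connected G R , 3≤n , noCut
  where
  excludes : (ds ! 2 + ds ! length ds ≥ length ds) ⊎ ¬ WitnessΣ ds →
    ¬ ((ds ! 2 + ds ! length ds < length ds) × WitnessΣ ds)
  excludes (inj₁ large) (small , _) = <⇒≱ small large
  excludes (inj₂ ¬w) (_ , w) = ¬w w
  noCut : ∀ x u v → u ≢ x → v ≢ x → ReachIn G (λ w → w ≢ x) u v
  noCut x u v u≢x v≢x = decidable-stable (Reachability.reachable? G (λ w → ¬? (w Finₚ.≟ x)) u v)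
    λ ¬reach → excludes excluded
      (cutVertex⇒witness ni R (proj₂ (connected G R)) (x , u , v , u≢x , v≢x , ¬reach))

mainTheorem1 : (ds : List ℕ) → NonIncreasing ds → ZeroFree ds → Graphical ds →
    ForciblyP Biconnected ds ⇔
      (PotentiallyP Biconnected ds × ForciblyP Connected ds ×
        (((ds ! 2) + (ds ! length ds) ≥ length ds) ⊎
          ¬ (Σ ℕ λ d → Σ ℕ λ s → Σ (List ℕ) λ sL → Σ ℕ λ d' → Witness ds d s sL d')))
mainTheorem1 ds ni zf (G , R) = mk⇔
  (λ biconnected → (G , R , biconnected G R) , (λ H RH → proj₁ (biconnected H RH)) ,
                   inj₂ (forciblyBiconnected⇒¬witness zf biconnected))
  (λ (potentially , connected , excluded) → conditions⇒forciblyBiconnected ni potentially connected excluded)
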